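{- Let $n,k$ be positive integers with $n\ge 2k$. Any two well-spread $k$-subsets of $[n]$ are obtained from each other by a rotation of $C_n$ (a map $i\mapsto i+t \pmod n$). In particular, $Q(n,k)$ is vertex-transitive, and if $\gcd(n,k)=1$ then $|V(Q(n,k))|=n$.
   Context: For a positive integer $n$ let $[n]=\{1,\dots,n\}$ and let $C_n$ be the cycle on $[n]$ with edges $\{i,i+1\}$ ($1\le i\le n-1$) and $\{n,1\}$. The Schrijver graph $\mathrm{SG}(n,k)$ ($n\ge 2k$) has as vertices the $k$-subsets of $[n]$ containing no two cyclically consecutive elements, two vertices adjacent iff they are disjoint. An arc of $C_n$ is a set $\{i,i+1,\dots,i+m-1\}$ (addition mod $n$) with $1\le m\le n-1$. A set $U\subseteq[n]$ is well-spread if for any two arcs $A,B$ with $|A|=|B|$ we have $\big||A\cap U|-|B\cap U|\big|\le 1$. $Q(n,k)$ is the induced subgraph of $\mathrm{SG}(n,k)$ on all well-spread $k$-subsets of $[n]$. -}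

module Defs where

open import Data.Nat using (ℕ; zero; suc; _+_; _∸_; _≤_; _%_; ∣_-_∣)
open import Data.Nat.DivMod using (m%n<n)
open import Data.Bool using (Bool; true; false)
open import Data.Fin using (Fin; toℕ; fromℕ<)
open import Data.Fin.Subset using (Subset; _∈_; ∣_∣)
open import Data.Vec using (lookup)
open import Data.List using (List; map; upTo)
open import Data.Nat.ListAction using (sum)
open import Data.List.Relation.Unary.Unique.Propositional using (Unique)
import Data.List.Membership.Propositional as LM
open import Data.Product using (Σ; _×_; ∃)
open import Relation.Binary.PropositionalEquality using (_≡_)
open import Relation.Nullary using (¬_)

-- The ground set [n] is modelled as Fin n = {0,…,n-1} (element i+1 of the
-- paper is represented by i); the cycle C_n has edges {i, i+1 mod n}.

shift : ∀ {n} → ℕ → Fin n → Fin n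
shift {suc m} t i = fromℕ< (m%n<n (toℕ i + t) (suc m))

rot : ∀ {n} → ℕ → Fin n → Fin n
rot = shift

ind : Bool → ℕ
ind true  = 1
ind false = 0

arcCount : ∀ {n} → Subset n → Fin n → ℕ → ℕ
arcCount U i m = sum (map (λ j → ind (lookup U (shift j i))) (upTo m))

WellSpread : ∀ {n} → Subset n → Set
WellSpread {n} U = ∀ (i j : Fin n) (m : ℕ) → 1 ≤ m → m ≤ n ∸ 1 →
  ∣ arcCount U i m - arcCount U j m ∣ ≤ 1

Stable : ∀ {n} → Subset n → Set
Stable U = ∀ i → ¬ (i ∈ U × shift 1 i ∈ U)

SGVertex : (n k : ℕ) → Subset n → Set
SGVertex n k U = ∣ U ∣ ≡ k × Stable U

QVertex : (n k : ℕ) → Subset n → Set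
QVertex n k U = SGVertex n k U × WellSpread U

Adj : ∀ {n} → Subset n → Subset n → Set
Adj U V = ∀ i → ¬ (i ∈ U × i ∈ V)

RotatedBy : ∀ {n} → ℕ → Subset n → Subset n → Set
RotatedBy {n} t U V = (∀ (i : Fin n) → i ∈ U → rot t i ∈ V)
                    × (∀ (j : Fin n) → j ∈ V → Σ (Fin n) λ i → i ∈ U × rot t i ≡ j)

IsAutomorphism : ∀ {n} → (Subset n → Set) → (Subset n → Subset n) → Set
IsAutomorphism {n} P f =
    (∀ U → P U → P (f U))
  × (∀ U V → P U → P V → f U ≡ f V → U ≡ V)
  × (∀ V → P V → Σ (Subset n) λ U → P U × f U ≡ V)
  × (∀ U V → P U → P V → (Adj U V → Adj (f U) (f V)) × (Adj (f U) (f V) → Adj U V))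

VertexTransitive : ∀ {n} → (Subset n → Set) → Set
VertexTransitive {n} P = ∀ U V → P U → P V →
  Σ (Subset n → Subset n) λ f → IsAutomorphism P f × f U ≡ V

HasCardinality : ∀ {n} → (Subset n → Set) → ℕ → Set
HasCardinality {n} P c = Σ (List (Subset n)) λ L →
  Unique L × Data.List.length L ≡ c × (∀ U → (U LM.∈ L → P U) × (P U → U LM.∈ L))
  where import Data.List

module Submission where

-- Encode a subset of the n-cycle by its n-periodic indicator sequence; well-spreadness
-- says that equally long windows of the sequence contain numbers of ones differing by at
-- most one. Read from a position s minimising n·#(ones in [0,s)) − s·k, every prefix of
-- length m contains at least mk/n ones, and balance forbids mk/n + 1 or more (otherwise
-- all n windows of length m following s would together hold more than mk ones), so it
-- contains exactly ⌈mk/n⌉. Two vertices of Q(n,k) therefore agree after shifting each to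
-- its minimising position: they are rotations of each other, and rotations are graph
-- automorphisms. The lower mechanical word ⌊(x+1)k/n⌋ − ⌊xk/n⌋ is a vertex (stable as
-- 2k ≤ n). If gcd(n,k) = 1, a period d of a vertex gives n·#(ones in [0,d)) = dk, hence
-- n ∣ d, so its n rotations are pairwise distinct.

open import Data.Bool using (Bool; true; false)
open import Data.Empty using (⊥-elim)
open import Data.Fin using (Fin; zero; suc; toℕ)
open import Data.Fin.Properties using (toℕ-fromℕ<; toℕ-injective; toℕ<n)
open import Data.Fin.Subset using (Subset; _∈_; ∣_∣)
open import Data.List using (List; map; length; upTo; applyUpTo; allFin)
open import Data.List.Extrema.Nat using (argmin; argmin-sel; f[argmin]≤f[xs])
import Data.List.Membership.Propositional as LM
open import Data.List.Membership.Propositional.Properties using (∈-upTo⁺; ∈-upTo⁻; ∈-map⁺; ∈-map⁻; ∈-allFin)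
open import Data.List.Properties using (map-applyUpTo; length-map; length-tabulate)
import Data.List.Relation.Unary.All as All
open import Data.List.Relation.Unary.Unique.Propositional using (Unique)
open import Data.List.Relation.Unary.Unique.Propositional.Properties using (map⁺; allFin⁺)
open import Data.Nat
open import Data.Nat.Coprimality using (Coprime; coprime-divisor; gcd≡1⇒coprime)
open import Data.Nat.Divisibility using (_∣_; divides; n∣m*n; >⇒∤)
open import Data.Nat.DivMod
open import Data.Nat.GCD using (gcd)
open import Data.Nat.ListAction using (sum)
open import Data.Nat.Properties
open import Algebra.Properties.CommutativeSemigroup +-commutativeSemigroup
  using (interchange; xy∙z≈xz∙y; xy∙z≈x∙zy; xy∙z≈y∙xz; xy∙z≈zy∙x; x∙yz≈y∙xz; x∙yz≈yz∙x)
open import Data.Nat.Tactic.RingSolver using (solve-∀)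
open import Data.Product using (Σ; ∃; _×_; _,_; proj₁; proj₂)
open import Data.Sum using (inj₁; inj₂)
open import Data.Vec using (Vec; []; _∷_; lookup; tabulate)
open import Data.Vec.Properties using ([]=⇒lookup; lookup⇒[]=; lookup∘tabulate; tabulate∘lookup; tabulate-cong)
open import Function using (_∘_; id)
open import Relation.Binary.Definitions using (tri<; tri≈; tri>)
open import Relation.Binary.PropositionalEquality
open import Relation.Nullary using (¬_; yes; no)
open import Relation.Nullary.Reflects using (ofʸ; ofⁿ)

open import Defs

arcSum : (ℕ → ℕ) → ℕ → ℕ → ℕ
arcSum h a zero    = 0
arcSum h a (suc m) = h a + arcSum h (suc a) m

arcSum-cong : ∀ {h g} a b m → (∀ j → h (a + j) ≡ g (b + j)) → arcSum h a m ≡ arcSum g b m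
arcSum-cong a b zero    eq = refl
arcSum-cong {h} {g} a b (suc m) eq = cong₂ _+_ head (arcSum-cong (suc a) (suc b) m tail)
  where
    head : h a ≡ g b
    head = subst₂ (λ x y → h x ≡ g y) (+-identityʳ a) (+-identityʳ b) (eq 0)
    tail : ∀ j → h (suc a + j) ≡ g (suc b + j)
    tail j = subst₂ (λ x y → h x ≡ g y) (+-suc a j) (+-suc b j) (eq (suc j))

arcSum-+ : ∀ h a m n → arcSum h a (m + n) ≡ arcSum h a m + arcSum h (a + m) n
arcSum-+ h a zero    n = cong (λ x → arcSum h x n) (sym (+-identityʳ a))
arcSum-+ h a (suc m) n = begin
  h a + arcSum h (suc a) (m + n)                        ≡⟨ cong (h a +_) (arcSum-+ h (suc a) m n) ⟩
  h a + (arcSum h (suc a) m + arcSum h (suc a + m) n)   ≡⟨ sym (+-assoc (h a) _ _) ⟩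
  h a + arcSum h (suc a) m + arcSum h (suc a + m) n     ≡⟨ cong (λ x → h a + arcSum h (suc a) m + arcSum h x n)
                                                              (sym (+-suc a m)) ⟩
  h a + arcSum h (suc a) m + arcSum h (a + suc m) n     ∎
  where open ≡-Reasoning

arcSum-suc : ∀ h a m → arcSum h a (suc m) ≡ arcSum h a m + h (a + m)
arcSum-suc h a m = begin
  arcSum h a (suc m)               ≡⟨ cong (arcSum h a) (+-comm 1 m) ⟩
  arcSum h a (m + 1)               ≡⟨ arcSum-+ h a m 1 ⟩
  arcSum h a m + (h (a + m) + 0)   ≡⟨ cong (arcSum h a m +_) (+-identityʳ _) ⟩
  arcSum h a m + h (a + m)         ∎
  where open ≡-Reasoning

Periodic : ℕ → (ℕ → ℕ) → Set
Periodic p h = ∀ y → h (y + p) ≡ h y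

module _ {p h} (per : Periodic p h) where

  periodic-+* : ∀ y q → h (y + q * p) ≡ h y
  periodic-+* y zero    = cong h (+-identityʳ y)
  periodic-+* y (suc q) = begin
    h (y + (p + q * p))   ≡⟨ cong h (trans (cong (y +_) (+-comm p (q * p))) (sym (+-assoc y (q * p) p))) ⟩
    h (y + q * p + p)     ≡⟨ per (y + q * p) ⟩
    h (y + q * p)         ≡⟨ periodic-+* y q ⟩
    h y                   ∎
    where open ≡-Reasoning

  arcSum-period : ∀ a → arcSum h a p ≡ arcSum h 0 p
  arcSum-period zero    = refl
  arcSum-period (suc a) = trans (+-cancelˡ-≡ (h a) _ _ shifted) (arcSum-period a)
    where
      shifted : h a + arcSum h (suc a) p ≡ h a + arcSum h a p
      shifted = begin
        arcSum h a (suc p)             ≡⟨ arcSum-suc h a p ⟩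
        arcSum h a p + h (a + p)       ≡⟨ cong (arcSum h a p +_) (per a) ⟩
        arcSum h a p + h a             ≡⟨ +-comm _ (h a) ⟩
        h a + arcSum h a p             ∎
        where open ≡-Reasoning

  arcSum-*period : ∀ a q → arcSum h a (q * p) ≡ q * arcSum h 0 p
  arcSum-*period a zero    = refl
  arcSum-*period a (suc q) = trans (arcSum-+ h a p (q * p))
    (cong₂ _+_ (arcSum-period a) (arcSum-*period (a + p) q))

  periodic-% : .{{_ : NonZero p}} → ∀ y → h (y % p) ≡ h y
  periodic-% y = trans (sym (periodic-+* (y % p) (y / p))) (cong h (sym (m≡m%n+[m/n]*n y p)))

  periodic-≡mod : .{{_ : NonZero p}} → ∀ y z → y % p ≡ z % p → h y ≡ h z
  periodic-≡mod y z eq = trans (sym (periodic-% y)) (trans (cong h eq) (periodic-% z))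

*<*+⇒≤ : ∀ n {a b} → n * a < n * b + n → a ≤ b
*<*+⇒≤ n {a} {b} lt = ≤-pred (*-cancelˡ-< n a (suc b) (subst (n * a <_) n*b+n≡n*[1+b] lt))
  where
    n*b+n≡n*[1+b] : n * b + n ≡ n * suc b
    n*b+n≡n*[1+b] = trans (+-comm (n * b) n) (sym (*-suc n b))

*-window-unique : ∀ n {a b} x → x ≤ n * a → n * a < x + n → x ≤ n * b → n * b < x + n → a ≡ b
*-window-unique n x x≤na na<x+n x≤nb nb<x+n = ≤-antisym
  (*<*+⇒≤ n (<-≤-trans na<x+n (+-monoˡ-≤ n x≤nb)))
  (*<*+⇒≤ n (<-≤-trans nb<x+n (+-monoˡ-≤ n x≤na)))

arcSum-*-lower : ∀ {h} n m c → (∀ i → c ≤ n * arcSum h i m) → ∀ J a → J * c ≤ n * arcSum h a (J * m)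
arcSum-*-lower n m c low zero    a = z≤n
arcSum-*-lower {h} n m c low (suc J) a = begin
  c + J * c                                           ≤⟨ +-mono-≤ (low a) (arcSum-*-lower n m c low J (a + m)) ⟩
  n * arcSum h a m + n * arcSum h (a + m) (J * m)     ≡⟨ sym (*-distribˡ-+ n _ _) ⟩
  n * (arcSum h a m + arcSum h (a + m) (J * m))       ≡⟨ cong (n *_) (sym (arcSum-+ h a m (J * m))) ⟩
  n * arcSum h a (m + J * m)                          ∎
  where open ≤-Reasoning

Balanced : ℕ → (ℕ → ℕ) → Set
Balanced N h = ∀ i j m → m ≤ N → arcSum h i m ≤ arcSum h j m + 1

MechanicalFrom : ℕ → ℕ → (ℕ → ℕ) → ℕ → Set
MechanicalFrom N k h s = ∀ m → m ≤ N → m * k ≤ N * arcSum h s m × N * arcSum h s m < m * k + N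

mechanical-agree : ∀ {N k h g s t} → MechanicalFrom N k h s → MechanicalFrom N k g t →
                   ∀ m → m < N → h (s + m) ≡ g (t + m)
mechanical-agree {N} {k} {h} {g} {s} {t} mh mg m m<N = +-cancelˡ-≡ (arcSum h s m) _ _ (begin
  arcSum h s m + h (s + m)   ≡⟨ sym (arcSum-suc h s m) ⟩
  arcSum h s (suc m)         ≡⟨ prefix (suc m) m<N ⟩
  arcSum g t (suc m)         ≡⟨ arcSum-suc g t m ⟩
  arcSum g t m + g (t + m)   ≡⟨ cong (_+ g (t + m)) (sym (prefix m (<⇒≤ m<N))) ⟩
  arcSum h s m + g (t + m)   ∎)
  where
    open ≡-Reasoning
    prefix : ∀ m → m ≤ N → arcSum h s m ≡ arcSum g t m
    prefix m m≤N with mh m m≤N | mg m m≤N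
    ... | lh , uh | lg , ug = *-window-unique N (m * k) lh uh lg ug

module _ {N k h} .{{_ : NonZero N}} (per : Periodic N h) (total : arcSum h 0 N ≡ k) where

  arcSum-*N : ∀ a m → arcSum h a (N * m) ≡ m * k
  arcSum-*N a m = trans (cong (arcSum h a) (*-comm N m)) (trans (arcSum-*period per a m) (cong (m *_) total))

  balanced-upper : Balanced N h → ∀ s m → m ≤ N → N * arcSum h s m < m * k + N
  balanced-upper bal s m m≤N with m * k + N ≤? N * arcSum h s m
  ... | no ¬big = ≰⇒> ¬big
  ... | yes big = ⊥-elim (<-irrefl refl (<-≤-trans (m<m+n (N * (m * k)) (>-nonZero⁻¹ N)) (begin
    N * (m * k) + N                                        ≡⟨ cong (_+ N) (*≡+pred* (m * k)) ⟩
    m * k + pred N * (m * k) + N                           ≡⟨ xy∙z≈xz∙y (m * k) _ N ⟩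
    m * k + N + pred N * (m * k)                           ≤⟨ +-mono-≤ big (arcSum-*-lower N m (m * k) low (pred N) (s + m)) ⟩
    N * arcSum h s m + N * arcSum h (s + m) (pred N * m)   ≡⟨ sym windows ⟩
    N * arcSum h s (N * m)                                 ≡⟨ cong (N *_) (arcSum-*N s m) ⟩
    N * (m * k)                                            ∎)))
    where
      open ≤-Reasoning
      *≡+pred* : ∀ x → N * x ≡ x + pred N * x
      *≡+pred* x = cong (_* x) (sym (suc-pred N))
      windows : N * arcSum h s (N * m) ≡ N * arcSum h s m + N * arcSum h (s + m) (pred N * m)
      windows = trans (cong (λ l → N * arcSum h s l) (*≡+pred* m))
                      (trans (cong (N *_) (arcSum-+ h s m (pred N * m))) (*-distribˡ-+ N _ _))
      low : ∀ i → m * k ≤ N * arcSum h i m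
      low i = +-cancelʳ-≤ N _ _ (begin
        m * k + N               ≤⟨ big ⟩
        N * arcSum h s m        ≤⟨ *-monoʳ-≤ N (bal s i m m≤N) ⟩
        N * (arcSum h i m + 1)  ≡⟨ trans (*-distribˡ-+ N _ 1) (cong (N * arcSum h i m +_) (*-identityʳ N)) ⟩
        N * arcSum h i m + N    ∎)

  -- N·(number of ones in [0,x)) − x·k, shifted by N·k so that it stays in ℕ for x ≤ N
  discrepancy : ℕ → ℕ
  discrepancy x = N * arcSum h 0 x + (N ∸ x) * k

  minimalStart : ℕ
  minimalStart = argmin discrepancy 0 (upTo N)

  minimalStart<N : minimalStart < N
  minimalStart<N with argmin-sel discrepancy 0 (upTo N)
  ... | inj₁ s≡0 = subst (_< N) (sym s≡0) (>-nonZero⁻¹ N)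
  ... | inj₂ s∈  = ∈-upTo⁻ s∈

  private
    s = minimalStart

  minimalStart-discrepancy : ∀ x → x < N → discrepancy s ≤ discrepancy x
  minimalStart-discrepancy x x<N = All.lookup (f[argmin]≤f[xs] {f = discrepancy} 0 (upTo N)) (∈-upTo⁺ x<N)

  minimalStart-minimal< : ∀ x → x < N → N * arcSum h 0 s + x * k ≤ N * arcSum h 0 x + s * k
  minimalStart-minimal< x x<N = +-cancelʳ-≤ (N * k) _ _ (begin
    N * arcSum h 0 s + x * k + N * k                 ≡⟨ cong (N * arcSum h 0 s + x * k +_) (sym (split s s≤N)) ⟩
    N * arcSum h 0 s + x * k + ((N ∸ s) * k + s * k) ≡⟨ interchange (N * arcSum h 0 s) (x * k) _ (s * k) ⟩
    discrepancy s + (x * k + s * k)                  ≤⟨ +-monoˡ-≤ _ (minimalStart-discrepancy x x<N) ⟩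
    discrepancy x + (x * k + s * k)                  ≡⟨ swap′ (N * arcSum h 0 x) ((N ∸ x) * k) (x * k) (s * k) ⟩
    N * arcSum h 0 x + s * k + ((N ∸ x) * k + x * k) ≡⟨ cong (N * arcSum h 0 x + s * k +_) (split x (<⇒≤ x<N)) ⟩
    N * arcSum h 0 x + s * k + N * k                 ∎)
    where
      open ≤-Reasoning
      s≤N = <⇒≤ minimalStart<N
      split : ∀ y → y ≤ N → (N ∸ y) * k + y * k ≡ N * k
      split y y≤N = trans (sym (*-distribʳ-+ k (N ∸ y) y)) (cong (_* k) (m∸n+n≡m y≤N))
      swap′ : ∀ a b c d → a + b + (c + d) ≡ a + d + (b + c)
      swap′ = solve-∀

  minimalStart-minimal : ∀ x → N * arcSum h 0 s + x * k ≤ N * arcSum h 0 x + s * k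
  minimalStart-minimal x = subst (λ y → N * arcSum h 0 s + y * k ≤ N * arcSum h 0 y + s * k)
    (sym (m≡m%n+[m/n]*n x N)) (begin
      N * arcSum h 0 s + (r + q * N) * k        ≡⟨ expand (N * arcSum h 0 s) r q N k ⟩
      N * arcSum h 0 s + r * k + N * (q * k)    ≤⟨ +-monoˡ-≤ _ (minimalStart-minimal< r (m%n<n x N)) ⟩
      N * arcSum h 0 r + s * k + N * (q * k)    ≡⟨ collect N (arcSum h 0 r) (q * k) (s * k) ⟩
      N * (arcSum h 0 r + q * k) + s * k        ≡⟨ cong (λ c → N * c + s * k) (sym prefix) ⟩
      N * arcSum h 0 (r + q * N) + s * k        ∎)
    where
      open ≤-Reasoning
      r = x % N
      q = x / N
      prefix : arcSum h 0 (r + q * N) ≡ arcSum h 0 r + q * k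
      prefix = trans (arcSum-+ h 0 r (q * N)) (cong (arcSum h 0 r +_) (trans (arcSum-*period per r q) (cong (q *_) total)))
      expand : ∀ a r q n k → a + (r + q * n) * k ≡ a + r * k + n * (q * k)
      expand = solve-∀
      collect : ∀ n a b c → n * a + c + n * b ≡ n * (a + b) + c
      collect = solve-∀

  minimalStart-mechanical : Balanced N h → MechanicalFrom N k h minimalStart
  minimalStart-mechanical bal m m≤N = lower , balanced-upper bal s m m≤N
    where
      lower : m * k ≤ N * arcSum h s m
      lower = +-cancelˡ-≤ (N * arcSum h 0 s + s * k) _ _ (begin
        N * arcSum h 0 s + s * k + m * k          ≡⟨ +-assoc (N * arcSum h 0 s) (s * k) (m * k) ⟩
        N * arcSum h 0 s + (s * k + m * k)        ≡⟨ cong (N * arcSum h 0 s +_) (sym (*-distribʳ-+ k s m)) ⟩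
        N * arcSum h 0 s + (s + m) * k            ≤⟨ minimalStart-minimal (s + m) ⟩
        N * arcSum h 0 (s + m) + s * k            ≡⟨ cong (λ c → N * c + s * k) (arcSum-+ h 0 s m) ⟩
        N * (arcSum h 0 s + arcSum h s m) + s * k ≡⟨ distribute N (arcSum h 0 s) (arcSum h s m) (s * k) ⟩
        N * arcSum h 0 s + s * k + N * arcSum h s m ∎)
        where
          open ≤-Reasoning
          distribute : ∀ n a b c → n * (a + b) + c ≡ n * a + c + n * b
          distribute = solve-∀

-- (N − 1)·c is an additive inverse of c modulo N that avoids truncated subtraction
negMod : ℕ → ℕ → ℕ
negMod N c = pred N * c

module _ {N} .{{_ : NonZero N}} where

  ∣+negMod : ∀ c → N ∣ c + negMod N c
  ∣+negMod c = divides c (trans (cong (_* c) (suc-pred N)) (*-comm N c))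

  [m+c+negMod]%≡m% : ∀ a c → (a + c + negMod N c) % N ≡ a % N
  [m+c+negMod]%≡m% a c = trans (cong (_% N) (+-assoc a c _)) (%-remove-+ʳ a (∣+negMod c))

  [m+negMod+c]%≡m% : ∀ a c → (a + negMod N c + c) % N ≡ a % N
  [m+negMod+c]%≡m% a c = trans (cong (_% N) (xy∙z≈x∙zy a _ c))
                                (%-remove-+ʳ a (∣+negMod c))

  [m+n%N]%N≡[m+n]%N : ∀ a b → (a + b % N) % N ≡ (a + b) % N
  [m+n%N]%N≡[m+n]%N a b = begin
    (a + b % N) % N             ≡⟨ %-distribˡ-+ a (b % N) N ⟩
    (a % N + b % N % N) % N     ≡⟨ cong (λ x → (a % N + x) % N) (m%n%n≡m%n b N) ⟩
    (a % N + b % N) % N         ≡⟨ sym (%-distribˡ-+ a b N) ⟩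
    (a + b) % N                 ∎
    where open ≡-Reasoning

balanced-translate : ∀ {N k h g} .{{_ : NonZero N}} → Periodic N h → Periodic N g →
                     arcSum h 0 N ≡ k → arcSum g 0 N ≡ k → Balanced N h → Balanced N g →
                     ∃ λ c → ∀ y → g y ≡ h (y + c)
balanced-translate {N} {k} {h} {g} ph pg th tg bh bg = s + negMod N t , translate
  where
    s = minimalStart ph th
    t = minimalStart pg tg
    agree = mechanical-agree (minimalStart-mechanical ph th bh) (minimalStart-mechanical pg tg bg)
    translate : ∀ y → g y ≡ h (y + (s + negMod N t))
    translate y = begin
      g y        ≡⟨ periodic-≡mod pg y (t + m) (sym (begin
                      (t + m) % N                     ≡⟨ [m+n%N]%N≡[m+n]%N t _ ⟩
                      (t + (y + negMod N t)) % N      ≡⟨ cong (_% N) (x∙yz≈yz∙x t y (negMod N t)) ⟩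
                      (y + negMod N t + t) % N        ≡⟨ [m+negMod+c]%≡m% y t ⟩
                      y % N                           ∎)) ⟩
      g (t + m)  ≡⟨ sym (agree m (m%n<n _ N)) ⟩
      h (s + m)  ≡⟨ periodic-≡mod ph (s + m) _ (begin
                      (s + m) % N                     ≡⟨ [m+n%N]%N≡[m+n]%N s _ ⟩
                      (s + (y + negMod N t)) % N      ≡⟨ cong (_% N) (x∙yz≈y∙xz s y (negMod N t)) ⟩
                      (y + (s + negMod N t)) % N      ∎) ⟩
      h (y + (s + negMod N t)) ∎
      where
        open ≡-Reasoning
        m = (y + negMod N t) % N

module Mechanical (N k : ℕ) .{{_ : NonZero N}} (k≤N : k ≤ N) where

  level : ℕ → ℕ
  level x = x * k / N

  N*level≤ : ∀ x → N * level x ≤ x * k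
  N*level≤ x = ≤-trans (≤-reflexive (*-comm N (level x))) (m/n*n≤m (x * k) N)

  <N*level+N : ∀ x → x * k < N * level x + N
  <N*level+N x = begin-strict
    x * k                           ≡⟨ m≡m%n+[m/n]*n (x * k) N ⟩
    (x * k) % N + level x * N       <⟨ +-monoˡ-< _ (m%n<n (x * k) N) ⟩
    N + level x * N                 ≡⟨ trans (+-comm N _) (cong (_+ N) (*-comm (level x) N)) ⟩
    N * level x + N                 ∎
    where open ≤-Reasoning

  level-mono : ∀ x → level x ≤ level (suc x)
  level-mono x = /-monoˡ-≤ N (m≤n+m (x * k) k)

  level-suc≤ : ∀ x → level (suc x) ≤ level x + 1
  level-suc≤ x = *<*+⇒≤ N (begin-strict
    N * level (suc x)          ≤⟨ N*level≤ (suc x) ⟩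
    k + x * k                  <⟨ +-monoʳ-< k (<N*level+N x) ⟩
    k + (N * level x + N)      ≤⟨ +-monoˡ-≤ _ k≤N ⟩
    N + (N * level x + N)      ≡⟨ regroup N (level x) ⟩
    N * (level x + 1) + N      ∎)
    where
      open ≤-Reasoning
      regroup : ∀ n a → n + (n * a + n) ≡ n * (a + 1) + n
      regroup = solve-∀

  -- bit x holds iff ⌊(x+1)k/N⌋ = ⌊xk/N⌋ + 1: word is the lower mechanical word of slope k/N
  bit : ℕ → Bool
  bit x = level x <ᵇ level (suc x)

  word : ℕ → ℕ
  word x = ind (bit x)

  word+level : ∀ x → word x + level x ≡ level (suc x)
  word+level x with bit x | <ᵇ-reflects-< (level x) (level (suc x))
  ... | true  | ofʸ lt  = ≤-antisym lt (subst (level (suc x) ≤_) (+-comm (level x) 1) (level-suc≤ x))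
  ... | false | ofⁿ ¬lt = ≤-antisym (level-mono x) (≮⇒≥ ¬lt)

  arcSum-word : ∀ a m → arcSum word a m + level a ≡ level (a + m)
  arcSum-word a zero    = cong level (sym (+-identityʳ a))
  arcSum-word a (suc m) = begin
    word a + arcSum word (suc a) m + level a   ≡⟨ xy∙z≈y∙xz (word a) _ (level a) ⟩
    arcSum word (suc a) m + (word a + level a) ≡⟨ cong (arcSum word (suc a) m +_) (word+level a) ⟩
    arcSum word (suc a) m + level (suc a)      ≡⟨ arcSum-word (suc a) m ⟩
    level (suc a + m)                          ≡⟨ cong level (sym (+-suc a m)) ⟩
    level (a + suc m)                          ∎
    where open ≡-Reasoning

  level-+N : ∀ x → level (x + N) ≡ level x + k
  level-+N x = begin
    (x + N) * k / N          ≡⟨ cong (_/ N) (*-distribʳ-+ k x N) ⟩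
    (x * k + N * k) / N      ≡⟨ cong (λ y → (x * k + y) / N) (*-comm N k) ⟩
    (x * k + k * N) / N      ≡⟨ +-distrib-/-∣ʳ (x * k) (n∣m*n k) ⟩
    level x + k * N / N      ≡⟨ cong (level x +_) (m*n/n≡m k N) ⟩
    level x + k              ∎
    where open ≡-Reasoning

  word-periodic : Periodic N word
  word-periodic y = +-cancelʳ-≡ (level y + k) _ _ (begin
    word (y + N) + (level y + k)   ≡⟨ cong (word (y + N) +_) (sym (level-+N y)) ⟩
    word (y + N) + level (y + N)   ≡⟨ word+level (y + N) ⟩
    level (suc y + N)              ≡⟨ level-+N (suc y) ⟩
    level (suc y) + k              ≡⟨ cong (_+ k) (sym (word+level y)) ⟩
    word y + level y + k           ≡⟨ +-assoc (word y) (level y) k ⟩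
    word y + (level y + k)         ∎)
    where open ≡-Reasoning

  word-total : arcSum word 0 N ≡ k
  word-total = begin
    arcSum word 0 N                 ≡⟨ sym (+-identityʳ _) ⟩
    arcSum word 0 N + 0             ≡⟨ cong (arcSum word 0 N +_) (sym (0/n≡0 N)) ⟩
    arcSum word 0 N + level 0       ≡⟨ arcSum-word 0 N ⟩
    level N                         ≡⟨ trans (cong (_/ N) (*-comm N k)) (m*n/n≡m k N) ⟩
    k                               ∎
    where open ≡-Reasoning

  N*arcSum-word : ∀ a m → N * arcSum word a m + N * level a ≡ N * level (a + m)
  N*arcSum-word a m = trans (sym (*-distribˡ-+ N _ _)) (cong (N *_) (arcSum-word a m))

  arcSum-word-upper : ∀ a m → N * arcSum word a m < m * k + N
  arcSum-word-upper a m = +-cancelʳ-< (N * level a) _ _ (begin-strict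
    N * arcSum word a m + N * level a  ≡⟨ N*arcSum-word a m ⟩
    N * level (a + m)                  ≤⟨ N*level≤ (a + m) ⟩
    (a + m) * k                        ≡⟨ *-distribʳ-+ k a m ⟩
    a * k + m * k                      <⟨ +-monoˡ-< (m * k) (<N*level+N a) ⟩
    N * level a + N + m * k            ≡⟨ xy∙z≈zy∙x (N * level a) N (m * k) ⟩
    m * k + N + N * level a            ∎)
    where open ≤-Reasoning

  arcSum-word-lower : ∀ a m → m * k < N * arcSum word a m + N
  arcSum-word-lower a m = +-cancelˡ-< (a * k) _ _ (begin-strict
    a * k + m * k                                ≡⟨ sym (*-distribʳ-+ k a m) ⟩
    (a + m) * k                                  <⟨ <N*level+N (a + m) ⟩
    N * level (a + m) + N                        ≡⟨ cong (_+ N) (sym (N*arcSum-word a m)) ⟩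
    N * arcSum word a m + N * level a + N        ≡⟨ xy∙z≈y∙xz (N * arcSum word a m) (N * level a) N ⟩
    N * level a + (N * arcSum word a m + N)      ≤⟨ +-monoˡ-≤ _ (N*level≤ a) ⟩
    a * k + (N * arcSum word a m + N)            ∎)
    where open ≤-Reasoning

  word-balanced : Balanced N word
  word-balanced i j m _ = *<*+⇒≤ N (begin-strict
    N * arcSum word i m              <⟨ arcSum-word-upper i m ⟩
    m * k + N                        <⟨ +-monoˡ-< N (arcSum-word-lower j m) ⟩
    N * arcSum word j m + N + N      ≡⟨ regroup N (arcSum word j m) ⟩
    N * (arcSum word j m + 1) + N    ∎)
    where
      open ≤-Reasoning
      regroup : ∀ n a → n * a + n + n ≡ n * (a + 1) + n
      regroup = solve-∀

  word-sparse : 2 * k ≤ N → ∀ y → word y + word (suc y) ≤ 1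
  word-sparse 2k≤N y = subst (_≤ 1) (cong (word y +_) (+-identityʳ _)) (*<*+⇒≤ N (begin-strict
    N * arcSum word y 2     <⟨ arcSum-word-upper y 2 ⟩
    2 * k + N               ≤⟨ +-monoˡ-≤ N 2k≤N ⟩
    N + N                   ≡⟨ cong (_+ N) (sym (*-identityʳ N)) ⟩
    N * 1 + N               ∎))
    where open ≤-Reasoning

period-multiple : ∀ {N k d h} → Periodic N h → arcSum h 0 N ≡ k → Coprime N k → Periodic d h → N ∣ d
period-multiple {N} {k} {d} {h} pN total coprime pd = coprime-divisor coprime (divides (arcSum h 0 d) (begin
  k * d                  ≡⟨ *-comm k d ⟩
  d * k                  ≡⟨ cong (d *_) (sym total) ⟩
  d * arcSum h 0 N       ≡⟨ sym (arcSum-*period pN 0 d) ⟩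
  arcSum h 0 (d * N)     ≡⟨ cong (arcSum h 0) (*-comm d N) ⟩
  arcSum h 0 (N * d)     ≡⟨ arcSum-*period pd 0 N ⟩
  N * arcSum h 0 d       ≡⟨ *-comm N _ ⟩
  arcSum h 0 d * N       ∎))
  where open ≡-Reasoning

periodic-difference : ∀ {N h} a d → Periodic N h → a ≤ N → (∀ y → h (y + a) ≡ h (y + (a + d))) → Periodic d h
periodic-difference {N} {h} a d pN a≤N same z = begin
  h (z + d)                      ≡⟨ sym (pN (z + d)) ⟩
  h (z + d + N)                  ≡⟨ cong (λ n → h (z + d + n)) (sym (m∸n+n≡m a≤N)) ⟩
  h (z + d + (N ∸ a + a))        ≡⟨ cong h (rearrange z d (N ∸ a) a) ⟩
  h (z + (N ∸ a) + (a + d))      ≡⟨ sym (same (z + (N ∸ a))) ⟩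
  h (z + (N ∸ a) + a)            ≡⟨ cong h (trans (+-assoc z (N ∸ a) a) (cong (z +_) (m∸n+n≡m a≤N))) ⟩
  h (z + N)                      ≡⟨ pN z ⟩
  h z                            ∎
  where
    open ≡-Reasoning
    rearrange : ∀ z d b a → z + d + (b + a) ≡ z + b + (a + d)
    rearrange = solve-∀

record WellSpreadSeq (N k : ℕ) (h : ℕ → ℕ) : Set where
  field
    periodic : Periodic N h
    total    : arcSum h 0 N ≡ k
    sparse   : ∀ y → h y + h (suc y) ≤ 1
    balanced : Balanced N h

arcSum-translate : ∀ {g h c} → (∀ y → g y ≡ h (y + c)) → ∀ a m → arcSum g a m ≡ arcSum h (a + c) m
arcSum-translate {g} {h} {c} g≡h a m = arcSum-cong a (a + c) m λ j →
  trans (g≡h (a + j)) (cong h (xy∙z≈xz∙y a j c))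

WellSpreadSeq-translate : ∀ {N k g h c} → WellSpreadSeq N k h → (∀ y → g y ≡ h (y + c)) → WellSpreadSeq N k g
WellSpreadSeq-translate {N} {k} {g} {h} {c} ws g≡h = record
  { periodic = λ y → begin
      g (y + N)      ≡⟨ g≡h (y + N) ⟩
      h (y + N + c)  ≡⟨ cong h (xy∙z≈xz∙y y N c) ⟩
      h (y + c + N)  ≡⟨ periodic (y + c) ⟩
      h (y + c)      ≡⟨ sym (g≡h y) ⟩
      g y            ∎
  ; total    = trans (arcSum-translate g≡h 0 N) (trans (arcSum-period periodic c) total)
  ; sparse   = λ y → subst (_≤ 1) (sym (cong₂ _+_ (g≡h y) (g≡h (suc y)))) (sparse (y + c))
  ; balanced = λ i j m m≤N → subst₂ (λ a b → a ≤ b + 1) (sym (arcSum-translate g≡h i m))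
                 (sym (arcSum-translate g≡h j m)) (balanced (i + c) (j + c) m m≤N)
  }
  where
    open ≡-Reasoning
    open WellSpreadSeq ws

sum-applyUpTo : ∀ f h a m → (∀ j → f j ≡ h (a + j)) → sum (applyUpTo f m) ≡ arcSum h a m
sum-applyUpTo f h a zero    f≡h = refl
sum-applyUpTo f h a (suc m) f≡h = cong₂ _+_ (trans (f≡h 0) (cong h (+-identityʳ a)))
  (sum-applyUpTo (f ∘ suc) h (suc a) m (λ j → trans (f≡h (suc j)) (cong h (+-suc a j))))

∣∣≡arcSum : ∀ {M} (p : Vec Bool M) h a → (∀ i → h (a + toℕ i) ≡ ind (lookup p i)) → ∣ p ∣ ≡ arcSum h a M
∣∣≡arcSum []       h a h≡p = refl
∣∣≡arcSum (x ∷ xs) h a h≡p = trans (∣∷∣ x) (cong₂ _+_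
  (sym (trans (cong h (sym (+-identityʳ a))) (h≡p zero)))
  (∣∣≡arcSum xs h (suc a) (λ i → trans (cong h (sym (+-suc a (toℕ i)))) (h≡p (suc i)))))
  where
    ∣∷∣ : ∀ x → ∣ x ∷ xs ∣ ≡ ind x + ∣ xs ∣
    ∣∷∣ true  = refl
    ∣∷∣ false = refl

∣m-n∣≤1⇒m≤n+1 : ∀ {m n} → ∣ m - n ∣ ≤ 1 → m ≤ n + 1
∣m-n∣≤1⇒m≤n+1 {m} {n} ∣m-n∣≤1 = ≤-trans (m≤n+∣m-n∣ m n) (+-monoʳ-≤ n ∣m-n∣≤1)

m≤n+1∧n≤m+1⇒∣m-n∣≤1 : ∀ {m n} → m ≤ n + 1 → n ≤ m + 1 → ∣ m - n ∣ ≤ 1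
m≤n+1∧n≤m+1⇒∣m-n∣≤1 {m} {n} m≤n+1 n≤m+1 with ∣m-n∣≡[m∸n]∨[n∸m] m n
... | inj₁ eq = subst (_≤ 1) (sym eq) (m≤n+o⇒m∸n≤o m n m≤n+1)
... | inj₂ eq = subst (_≤ 1) (sym eq) (m≤n+o⇒m∸n≤o n m n≤m+1)

ind+ind≤1 : ∀ a b → ¬ (a ≡ true × b ≡ true) → ind a + ind b ≤ 1
ind+ind≤1 true  true  ¬both = ⊥-elim (¬both (refl , refl))
ind+ind≤1 true  false _     = ≤-refl
ind+ind≤1 false true  _     = ≤-refl
ind+ind≤1 false false _     = z≤n

ind-injective : ∀ {a b} → ind a ≡ ind b → a ≡ b
ind-injective {true}  {true}  _ = refl
ind-injective {false} {false} _ = refl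
ind-injective {true}  {false} ()
ind-injective {false} {true}  ()

module Cycle (n₁ : ℕ) where

  N : ℕ
  N = suc n₁

  indicator : Subset N → ℕ → ℕ
  indicator U y = ind (lookup U (y mod N))

  mod-≡ : ∀ y z → y % N ≡ z % N → y mod N ≡ z mod N
  mod-≡ y z eq = toℕ-injective (trans (toℕ-fromℕ< (m%n<n y N)) (trans eq (sym (toℕ-fromℕ< (m%n<n z N)))))

  toℕ-mod : ∀ (i : Fin N) → toℕ i mod N ≡ i
  toℕ-mod i = toℕ-injective (trans (toℕ-fromℕ< (m%n<n (toℕ i) N)) (m<n⇒m%n≡m (toℕ<n i)))

  indicator-≡mod : ∀ U y z → y % N ≡ z % N → indicator U y ≡ indicator U z
  indicator-≡mod U y z eq = cong (λ i → ind (lookup U i)) (mod-≡ y z eq)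

  indicator-periodic : ∀ U → Periodic N (indicator U)
  indicator-periodic U y = indicator-≡mod U (y + N) y ([m+n]%n≡m%n y N)

  indicator-toℕ : ∀ U i → indicator U (toℕ i) ≡ ind (lookup U i)
  indicator-toℕ U i = cong (λ j → ind (lookup U j)) (toℕ-mod i)

  arcCount≡arcSum : ∀ U i m → arcCount U i m ≡ arcSum (indicator U) (toℕ i) m
  arcCount≡arcSum U i m = trans (cong sum (map-applyUpTo id _ m))
    (sum-applyUpTo _ (indicator U) (toℕ i) m (λ _ → refl))

  ∣U∣≡arcSum : ∀ U → ∣ U ∣ ≡ arcSum (indicator U) 0 N
  ∣U∣≡arcSum U = ∣∣≡arcSum U (indicator U) 0 (indicator-toℕ U)

  shift-mod : ∀ c y → shift c (y mod N) ≡ (y + c) mod N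
  shift-mod c y = mod-≡ (toℕ (y mod N) + c) (y + c) (begin
    (toℕ (y mod N) + c) % N   ≡⟨ cong (λ x → (x + c) % N) (toℕ-fromℕ< (m%n<n y N)) ⟩
    (y % N + c) % N           ≡⟨ cong (_% N) (+-comm (y % N) c) ⟩
    (c + y % N) % N           ≡⟨ [m+n%N]%N≡[m+n]%N {N} c y ⟩
    (c + y) % N               ≡⟨ cong (_% N) (+-comm c y) ⟩
    (y + c) % N               ∎)
    where open ≡-Reasoning

  shift-1≡suc : ∀ y → shift 1 (y mod N) ≡ suc y mod N
  shift-1≡suc y = trans (shift-mod 1 y) (cong (_mod N) (+-comm y 1))

  arcSum-indicator-% : ∀ U i m → arcSum (indicator U) i m ≡ arcSum (indicator U) (toℕ (i mod N)) m
  arcSum-indicator-% U i m = arcSum-cong i (toℕ (i mod N)) m λ j →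
    cong (λ a → ind (lookup U a)) (sym (shift-mod j i))

  stable⇒sparse : ∀ U → Stable U → ∀ y → indicator U y + indicator U (suc y) ≤ 1
  stable⇒sparse U stable y = subst (λ b → indicator U y + ind (lookup U b) ≤ 1) (shift-1≡suc y)
    (ind+ind≤1 (lookup U i) (lookup U (shift 1 i))
      (λ (p , q) → stable i (lookup⇒[]= i U p , lookup⇒[]= (shift 1 i) U q)))
    where i = y mod N

  sparse⇒stable : ∀ U → (∀ y → indicator U y + indicator U (suc y) ≤ 1) → Stable U
  sparse⇒stable U sparse i (i∈U , i+1∈U) = 1+n≰n (subst₂ (λ a b → ind a + ind b ≤ 1)
    (trans (cong (lookup U) (toℕ-mod i)) ([]=⇒lookup i∈U))
    (trans (cong (lookup U) (trans (sym (shift-1≡suc (toℕ i))) (cong (shift 1) (toℕ-mod i)))) ([]=⇒lookup i+1∈U))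
    (sparse (toℕ i)))

  wellSpread⇒balanced : ∀ U → WellSpread U → Balanced N (indicator U)
  wellSpread⇒balanced U ws i j m m≤N = subst₂ (λ a b → a ≤ b + 1)
    (sym (arcSum-indicator-% U i m)) (sym (arcSum-indicator-% U j m)) (onFin (i mod N) (j mod N) m m≤N)
    where
      onFin : ∀ (i j : Fin N) m → m ≤ N → arcSum (indicator U) (toℕ i) m ≤ arcSum (indicator U) (toℕ j) m + 1
      onFin i j zero    _   = z≤n
      onFin i j (suc m) m<N with m≤n⇒m<n∨m≡n m<N
      ... | inj₁ 1+m<N = ∣m-n∣≤1⇒m≤n+1 (subst₂ (λ a b → ∣ a - b ∣ ≤ 1)
                           (arcCount≡arcSum U i (suc m)) (arcCount≡arcSum U j (suc m))
                           (ws i j (suc m) (s≤s z≤n) (≤-pred 1+m<N)))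
      ... | inj₂ refl  = ≤-trans (≤-reflexive (trans (arcSum-period (indicator-periodic U) (toℕ i))
                           (sym (arcSum-period (indicator-periodic U) (toℕ j))))) (m≤m+n _ 1)

  balanced⇒wellSpread : ∀ U → Balanced N (indicator U) → WellSpread U
  balanced⇒wellSpread U bal i j m _ m≤n₁ = subst₂ (λ a b → ∣ a - b ∣ ≤ 1)
    (sym (arcCount≡arcSum U i m)) (sym (arcCount≡arcSum U j m))
    (m≤n+1∧n≤m+1⇒∣m-n∣≤1 (bal (toℕ i) (toℕ j) m m≤N) (bal (toℕ j) (toℕ i) m m≤N))
    where m≤N = m≤n⇒m≤1+n m≤n₁

  qvertex⇒wellSpreadSeq : ∀ {k} U → QVertex N k U → WellSpreadSeq N k (indicator U)
  qvertex⇒wellSpreadSeq U ((∣U∣≡k , stable) , ws) = record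
    { periodic = indicator-periodic U
    ; total    = trans (sym (∣U∣≡arcSum U)) ∣U∣≡k
    ; sparse   = stable⇒sparse U stable
    ; balanced = wellSpread⇒balanced U ws
    }

  wellSpreadSeq⇒qvertex : ∀ {k} U → WellSpreadSeq N k (indicator U) → QVertex N k U
  wellSpreadSeq⇒qvertex U seq = (trans (∣U∣≡arcSum U) total , sparse⇒stable U sparse) , balanced⇒wellSpread U balanced
    where open WellSpreadSeq seq

  rotate : ℕ → Subset N → Subset N
  rotate c U = tabulate (λ i → lookup U (shift c i))

  lookup-rotate : ∀ c U i → lookup (rotate c U) i ≡ lookup U (shift c i)
  lookup-rotate c U = lookup∘tabulate (λ i → lookup U (shift c i))

  ∈-rotate⁻ : ∀ c U i → i ∈ rotate c U → shift c i ∈ U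
  ∈-rotate⁻ c U i i∈ = lookup⇒[]= (shift c i) U (trans (sym (lookup-rotate c U i)) ([]=⇒lookup i∈))

  ∈-rotate⁺ : ∀ c U i → shift c i ∈ U → i ∈ rotate c U
  ∈-rotate⁺ c U i i+c∈ = lookup⇒[]= i (rotate c U) (trans (lookup-rotate c U i) ([]=⇒lookup i+c∈))

  subset-ext : ∀ {U V : Subset N} → (∀ i → lookup U i ≡ lookup V i) → U ≡ V
  subset-ext {U} {V} eq = trans (sym (tabulate∘lookup U)) (trans (tabulate-cong eq) (tabulate∘lookup V))

  shift-shift : ∀ c d i → (toℕ i + c + d) % N ≡ toℕ i % N → shift d (shift c i) ≡ i
  shift-shift c d i eq = trans (shift-mod d (toℕ i + c)) (trans (mod-≡ (toℕ i + c + d) (toℕ i) eq) (toℕ-mod i))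

  shift-negMod : ∀ c i → shift (negMod N c) (shift c i) ≡ i
  shift-negMod c i = shift-shift c (negMod N c) i ([m+c+negMod]%≡m% {N} (toℕ i) c)

  shift-negMod⁻ : ∀ c i → shift c (shift (negMod N c) i) ≡ i
  shift-negMod⁻ c i = shift-shift (negMod N c) c i ([m+negMod+c]%≡m% {N} (toℕ i) c)

  rotate-negMod : ∀ c U → rotate (negMod N c) (rotate c U) ≡ U
  rotate-negMod c U = subset-ext λ i → trans (lookup-rotate (negMod N c) (rotate c U) i)
    (trans (lookup-rotate c U (shift (negMod N c) i)) (cong (lookup U) (shift-negMod⁻ c i)))

  rotate-negMod⁻ : ∀ c U → rotate c (rotate (negMod N c) U) ≡ U
  rotate-negMod⁻ c U = subset-ext λ i → trans (lookup-rotate c (rotate (negMod N c) U) i)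
    (trans (lookup-rotate (negMod N c) U (shift c i)) (cong (lookup U) (shift-negMod c i)))

  rotate-% : ∀ c U → rotate c U ≡ rotate (c % N) U
  rotate-% c U = subset-ext λ i → trans (lookup-rotate c U i) (trans (cong (lookup U) (mod-≡ (toℕ i + c) (toℕ i + c % N)
    (sym ([m+n%N]%N≡[m+n]%N {N} (toℕ i) c)))) (sym (lookup-rotate (c % N) U i)))

  rotatedBy-rotate : ∀ c U → RotatedBy (negMod N c) U (rotate c U)
  rotatedBy-rotate c U =
      (λ i i∈U → ∈-rotate⁺ c U (shift (negMod N c) i) (subst (_∈ U) (sym (shift-negMod⁻ c i)) i∈U))
    , (λ j j∈ → shift c j , ∈-rotate⁻ c U j j∈ , shift-negMod c j)

  indicator-rotate : ∀ c U y → indicator (rotate c U) y ≡ indicator U (y + c)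
  indicator-rotate c U y = cong ind (trans (lookup-rotate c U (y mod N)) (cong (lookup U) (shift-mod c y)))

  rotate-qvertex : ∀ {k} c U → QVertex N k U → QVertex N k (rotate c U)
  rotate-qvertex c U q = wellSpreadSeq⇒qvertex (rotate c U)
    (WellSpreadSeq-translate (qvertex⇒wellSpreadSeq U q) (indicator-rotate c U))

  rotate-automorphism : ∀ {k} c → IsAutomorphism (QVertex N k) (rotate c)
  rotate-automorphism c =
      rotate-qvertex c
    , (λ U V _ _ eq → trans (sym (rotate-negMod c U)) (trans (cong (rotate (negMod N c)) eq) (rotate-negMod c V)))
    , (λ V q → rotate (negMod N c) V , rotate-qvertex (negMod N c) V q , rotate-negMod⁻ c V)
    , (λ U V _ _ → preserve U V , reflect U V)
    where
      preserve : ∀ U V → Adj U V → Adj (rotate c U) (rotate c V)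
      preserve U V disjoint i (i∈cU , i∈cV) = disjoint (shift c i) (∈-rotate⁻ c U i i∈cU , ∈-rotate⁻ c V i i∈cV)
      back : ∀ W i → i ∈ W → shift (negMod N c) i ∈ rotate c W
      back W i i∈W = ∈-rotate⁺ c W (shift (negMod N c) i) (subst (_∈ W) (sym (shift-negMod⁻ c i)) i∈W)
      reflect : ∀ U V → Adj (rotate c U) (rotate c V) → Adj U V
      reflect U V disjoint i (i∈U , i∈V) = disjoint (shift (negMod N c) i) (back U i i∈U , back V i i∈V)

  translate⇒rotate : ∀ U V c → (∀ y → indicator V y ≡ indicator U (y + c)) → V ≡ rotate c U
  translate⇒rotate U V c V≡U+c = subset-ext λ i → ind-injective (begin
    ind (lookup V i)                 ≡⟨ sym (indicator-toℕ V i) ⟩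
    indicator V (toℕ i)              ≡⟨ V≡U+c (toℕ i) ⟩
    ind (lookup U (shift c i))       ≡⟨ cong ind (sym (lookup-rotate c U i)) ⟩
    ind (lookup (rotate c U) i)      ∎)
    where open ≡-Reasoning

  qvertex-rotation : ∀ {k} U V → QVertex N k U → QVertex N k V → ∃ λ c → V ≡ rotate c U
  qvertex-rotation U V qU qV =
    let c , V≡U+c = balanced-translate (periodic sU) (periodic sV) (total sU) (total sV) (balanced sU) (balanced sV)
    in c , translate⇒rotate U V c V≡U+c
    where
      open WellSpreadSeq
      sU = qvertex⇒wellSpreadSeq U qU
      sV = qvertex⇒wellSpreadSeq V qV

  rotate-≡⇒translate-≡ : ∀ a b U → rotate a U ≡ rotate b U → ∀ y → indicator U (y + a) ≡ indicator U (y + b)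
  rotate-≡⇒translate-≡ a b U eq y =
    trans (sym (indicator-rotate a U y)) (trans (cong (λ W → indicator W y) eq) (indicator-rotate b U y))

  distinct-translates : ∀ {k} U → QVertex N k U → Coprime N k → ∀ a b → a < b → b < N →
                        ¬ (∀ y → indicator U (y + a) ≡ indicator U (y + b))
  distinct-translates U q coprime a b a<b b<N same = >⇒∤ {{>-nonZero 0<d}} d<N N∣d
    where
      d = b ∸ a
      0<d : 0 < d
      0<d = m<n⇒0<n∸m a<b
      d<N : d < N
      d<N = ≤-<-trans (m∸n≤m b a) b<N
      d-periodic : Periodic d (indicator U)
      d-periodic = periodic-difference a d (indicator-periodic U) (<⇒≤ (<-trans a<b b<N))
        λ y → trans (same y) (cong (λ x → indicator U (y + x)) (sym (m+[n∸m]≡n (<⇒≤ a<b))))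
      N∣d : N ∣ d
      N∣d = period-multiple (indicator-periodic U) (WellSpreadSeq.total (qvertex⇒wellSpreadSeq U q)) coprime d-periodic

  rotate-injective : ∀ {k} U → QVertex N k U → Coprime N k →
                     ∀ a b → rotate (toℕ a) U ≡ rotate (toℕ b) U → a ≡ b
  rotate-injective U q coprime a b eq with <-cmp (toℕ a) (toℕ b)
  ... | tri≈ _ a≡b _ = toℕ-injective a≡b
  ... | tri< a<b _ _ = ⊥-elim (distinct-translates U q coprime _ _ a<b (toℕ<n b) (rotate-≡⇒translate-≡ _ _ U eq))
  ... | tri> _ _ b<a = ⊥-elim (distinct-translates U q coprime _ _ b<a (toℕ<n a) (rotate-≡⇒translate-≡ _ _ U (sym eq)))

  qvertices-rotated : ∀ {k} U V → QVertex N k U → QVertex N k V → Σ ℕ λ t → RotatedBy t U V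
  qvertices-rotated U V qU qV =
    let c , V≡rotate = qvertex-rotation U V qU qV
    in negMod N c , subst (RotatedBy (negMod N c) U) (sym V≡rotate) (rotatedBy-rotate c U)

  qvertex-vertexTransitive : ∀ {k} → VertexTransitive (QVertex N k)
  qvertex-vertexTransitive U V qU qV =
    let c , V≡rotate = qvertex-rotation U V qU qV
    in rotate c , rotate-automorphism c , sym V≡rotate

  module _ {k} (2k≤N : 2 * k ≤ N) where

    open Mechanical N k (≤-trans (m≤m+n k (k + 0)) 2k≤N)

    word-wellSpreadSeq : WellSpreadSeq N k word
    word-wellSpreadSeq = record
      { periodic = word-periodic
      ; total    = word-total
      ; sparse   = word-sparse 2k≤N
      ; balanced = word-balanced
      }

    mechanicalSubset : Subset N
    mechanicalSubset = tabulate (λ i → bit (toℕ i))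

    indicator-mechanicalSubset : ∀ y → indicator mechanicalSubset y ≡ word (y + 0)
    indicator-mechanicalSubset y = begin
      ind (lookup mechanicalSubset (y mod N))  ≡⟨ cong ind (lookup∘tabulate (λ i → bit (toℕ i)) (y mod N)) ⟩
      word (toℕ (y mod N))                     ≡⟨ cong word (toℕ-fromℕ< (m%n<n y N)) ⟩
      word (y % N)                             ≡⟨ periodic-% word-periodic y ⟩
      word y                                   ≡⟨ cong word (sym (+-identityʳ y)) ⟩
      word (y + 0)                             ∎
      where open ≡-Reasoning

    mechanicalSubset-qvertex : QVertex N k mechanicalSubset
    mechanicalSubset-qvertex = wellSpreadSeq⇒qvertex mechanicalSubset
      (WellSpreadSeq-translate word-wellSpreadSeq indicator-mechanicalSubset)

    qvertex-cardinality : Coprime N k → HasCardinality (QVertex N k) N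
    qvertex-cardinality coprime = rotations , unique , length-rotations , λ U → ∈⇒qvertex U , qvertex⇒∈ U
      where
        M = mechanicalSubset
        rotations : List (Subset N)
        rotations = map (λ a → rotate (toℕ a) M) (allFin N)
        unique : Unique rotations
        unique = map⁺ (rotate-injective M mechanicalSubset-qvertex coprime _ _) (allFin⁺ N)
        length-rotations : length rotations ≡ N
        length-rotations = trans (length-map _ (allFin N)) (length-tabulate id)
        ∈⇒qvertex : ∀ U → U LM.∈ rotations → QVertex N k U
        ∈⇒qvertex U U∈ =
          let a , _ , U≡rotate = ∈-map⁻ (λ a → rotate (toℕ a) M) U∈
          in subst (QVertex N k) (sym U≡rotate) (rotate-qvertex (toℕ a) M mechanicalSubset-qvertex)
        qvertex⇒∈ : ∀ U → QVertex N k U → U LM.∈ rotations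
        qvertex⇒∈ U q = subst (LM._∈ rotations) (sym U≡rotate[c%N])
                          (∈-map⁺ (λ a → rotate (toℕ a) M) (∈-allFin (c mod N)))
          where
            c = proj₁ (qvertex-rotation M U mechanicalSubset-qvertex q)
            U≡rotate = proj₂ (qvertex-rotation M U mechanicalSubset-qvertex q)
            U≡rotate[c%N] : U ≡ rotate (toℕ (c mod N)) M
            U≡rotate[c%N] = trans U≡rotate (trans (rotate-% c M)
                              (cong (λ i → rotate i M) (sym (toℕ-fromℕ< (m%n<n c N)))))

lemma11 : (n k : ℕ) → 1 ≤ k → 2 * k ≤ n →
    ((U V : Subset n) → QVertex n k U → QVertex n k V → Σ ℕ λ t → RotatedBy t U V)
    × VertexTransitive (QVertex n k)
    × (gcd n k ≡ 1 → HasCardinality (QVertex n k) n)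
lemma11 zero     (suc k) _ ()
lemma11 (suc n₁) k       _ 2k≤n =
    qvertices-rotated
  , qvertex-vertexTransitive
  , λ gcd≡1 → qvertex-cardinality 2k≤n (gcd≡1⇒coprime gcd≡1)
  where open Cycle n₁
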